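{- Let $G=(\mu;(a_1,b_1),\dots,(a_d,b_d))$ be bridge graph data of type $(k,n)$ with no lollipops, i.e. every $c\in[n]$ lies in $\{a_1,b_1,\dots,a_d,b_d\}$. Then there is a valid bridge diagram for $(k,n)$ corresponding to $G$.
   Context: Affine permutations: bijections $f:\mathbb{Z}\to\mathbb{Z}$ with $f(i+n)=f(i)+n$; a transposition $(a,b)$ swaps $a+sn$ and $b+sn$ for all $s$; $t_\mu(i)=i+n$ for $i\in\mu$, $t_\mu(i)=i$ for $i\in[n]\setminus\mu$, extended periodically. Bridge graph data of type $(k,n)$: a $k$-subset $\mu\subseteq[n]$ and pairs $(a_1,b_1),\dots,(a_d,b_d)$ with $1\le a_r<b_r\le n$ such that, with $f_0=t_\mu$ and $f_r=f_{r-1}\circ(a_r,b_r)$, for each $r$: (i) $f_{r-1}(a_r)>f_{r-1}(b_r)$; (ii) no $c$ with $a_r<c<b_r$ lies in $\{a_1,b_1,\dots,a_{r-1},b_{r-1}\}$; (iii) if $a_r$ is not among earlier bridge endpoints then $a_r\in\mu$, and if $b_r$ is not among earlier bridge endpoints then $b_r\notin\mu$. (This encodes a bridge graph built from the lollipop graph with white lollipops at $\mu$ by adding bridges in order.) For a reduced word $\mathbf{w}=s_{i_1}\cdots s_{i_m}$ and $J\subseteq[m]$, $u_{(j)}$ is the ordered product of letters at positions of $J$ up to $j$; $J$ is a positive distinguished subexpression (PDS) for $u=u_{(m)}$ if $u_{(j)}\le u_{(j-1)}s_{i_j}$ and $u_{(j-1)}<u_{(j-1)}s_{i_j}$ for all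 $j$. A valid bridge diagram for $(k,n)$ is a reduced word $\mathbf{w}$ together with the PDS $J$ for some $u$ anti-Grassmannian of type $(k,n)$ (decreasing on $[k]$ and on $[k+1,n]$). Its bridge sequence consists of, for each $j\notin J$, the transposition $u_{(j-1)}s_{i_j}u_{(j-1)}^{ -1}=(a,b)$ with $a<b$, listed in order of decreasing $j$. It corresponds to the bridge graph data $(u([k]);\text{its bridge sequence})$. -}

module Defs where

open import Data.Nat using (ℕ; zero; suc; _+_; _∸_; _≤_; _<_; _>_; _≟_; _<?_; _≡ᵇ_)
open import Data.Bool using (Bool; true; false; if_then_else_)
open import Data.List using (List; []; _∷_; map; length; filter; applyUpTo; reverse; take)
open import Data.List.Membership.Propositional using (_∈_; _∉_)
open import Data.List.Membership.DecPropositional _≟_ using (_∈?_)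
open import Data.List.Relation.Unary.All using (All)
open import Data.List.Relation.Unary.Unique.Propositional using (Unique)
open import Data.List.Relation.Binary.Pointwise using (Pointwise)
open import Data.Product using (Σ; _×_; _,_; ∃)
open import Data.Unit using (⊤)
open import Relation.Nullary using (¬_; does)
open import Relation.Binary.PropositionalEquality using (_≡_; _≢_)
open import Function using (_∘_)

swapN : ℕ → ℕ → ℕ → ℕ
swapN a b i = if i ≡ᵇ a then b else (if i ≡ᵇ b then a else i)

-- An affine permutation f (with f(i+n) = f(i)+n) is determined by its
-- values on [n] = {1,…,n}; we represent it by a function ℕ → ℕ whose
-- values at 1,…,n are f(1),…,f(n).  Transpositions (a,b) with
-- 1 ≤ a < b ≤ n preserve [n], so composition on the right with them is
-- computed on the window by ordinary composition with swapN a b.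

tμ : ℕ → List ℕ → ℕ → ℕ
tμ n μ i = if does (i ∈? μ) then i + n else i

endpoints : List (ℕ × ℕ) → List ℕ
endpoints [] = []
endpoints ((a , b) ∷ bs) = a ∷ b ∷ endpoints bs

-- conditions (i)-(iii) for the remaining bridges, given the current
-- affine permutation f = f_{r-1} and the earlier endpoints E
BridgesValid : ℕ → List ℕ → (ℕ → ℕ) → List ℕ → List (ℕ × ℕ) → Set
BridgesValid n μ f E [] = ⊤
BridgesValid n μ f E ((a , b) ∷ rest) =
  (1 ≤ a × a < b × b ≤ n)
  × f a > f b
  × (∀ c → a < c → c < b → c ∉ E)
  × (a ∉ E → a ∈ μ)
  × (b ∉ E → b ∉ μ)
  × BridgesValid n μ (f ∘ swapN a b) (a ∷ b ∷ E) rest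

IsKSubset : ℕ → ℕ → List ℕ → Set
IsKSubset k n μ = Unique μ × All (λ x → 1 ≤ x × x ≤ n) μ × length μ ≡ k

BridgeGraphData : ℕ → ℕ → List ℕ → List (ℕ × ℕ) → Set
BridgeGraphData k n μ bs = IsKSubset k n μ × BridgesValid n μ (tμ n μ) [] bs

NoLollipops : ℕ → List (ℕ × ℕ) → Set
NoLollipops n bs = ∀ c → 1 ≤ c → c ≤ n → c ∈ endpoints bs

-- Permutations of [n] in one-line notation: the list w(1),…,w(n).

Perm : Set
Perm = List ℕ

-- w(i), 1-indexed (0 out of range)
at : Perm → ℕ → ℕ
at [] _ = 0
at (x ∷ xs) zero = 0
at (x ∷ xs) (suc zero) = x
at (x ∷ xs) (suc (suc i)) = at xs (suc i)

-- position of x in w (1-indexed)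
indexOf : ℕ → Perm → ℕ
indexOf x [] = 0
indexOf x (y ∷ ys) = if x ≡ᵇ y then 1 else suc (indexOf x ys)

idPerm : ℕ → Perm
idPerm n = applyUpTo suc n

transp : ℕ → ℕ → ℕ → Perm
transp n a b = applyUpTo (λ x → swapN a b (suc x)) n

sPerm : ℕ → ℕ → Perm
sPerm n i = transp n i (suc i)

-- product u v = u ∘ v
mul : Perm → Perm → Perm
mul u v = map (at u) v

inverse : ℕ → Perm → Perm
inverse n u = applyUpTo (λ x → indexOf (suc x) u) n

-- Coxeter length = number of inversions
inv : Perm → ℕ
inv [] = 0
inv (x ∷ xs) = length (filter (λ y → y <? x) xs) + inv xs

wordPerm : ℕ → List ℕ → Perm
wordPerm n [] = idPerm n
wordPerm n (i ∷ w) = mul (sPerm n i) (wordPerm n w)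

Reduced : ℕ → List ℕ → Set
Reduced n w = All (λ i → 1 ≤ i × suc i ≤ n) w × length w ≡ inv (wordPerm n w)

data Bruhat (n : ℕ) (u : Perm) : Perm → Set where
  brefl : Bruhat n u u
  bstep : ∀ {v} p q → Bruhat n u v → 1 ≤ p → p < q → q ≤ n →
          inv v < inv (mul v (transp n p q)) →
          Bruhat n u (mul v (transp n p q))

BruhatLt : ℕ → Perm → Perm → Set
BruhatLt n u v = Bruhat n u v × u ≢ v

-- Subexpressions.  J ⊆ [m] is given as a Boolean list of length m
-- (true at position j iff j ∈ J).

-- the steps (u_{(j-1)}, i_j, [j ∈ J]) for j = 1,…,m, starting from u
steps : ℕ → Perm → List ℕ → List Bool → List (Perm × ℕ × Bool)
steps n u (i ∷ w) (b ∷ J) =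
  (u , i , b) ∷ steps n (if b then mul u (sPerm n i) else u) w J
steps n u _ _ = []

finalPerm : ℕ → Perm → List ℕ → List Bool → Perm
finalPerm n u (i ∷ w) (b ∷ J) =
  finalPerm n (if b then mul u (sPerm n i) else u) w J
finalPerm n u _ _ = u

PDSStep : ℕ → Perm × ℕ × Bool → Set
PDSStep n (u , i , b) =
  Bruhat n (if b then mul u (sPerm n i) else u) (mul u (sPerm n i))
  × BruhatLt n u (mul u (sPerm n i))

IsPDS : ℕ → List ℕ → List Bool → Set
IsPDS n w J = length J ≡ length w × All (PDSStep n) (steps n (idPerm n) w J)

AntiGrassmannian : ℕ → ℕ → Perm → Set
AntiGrassmannian k n u =
  (∀ p q → 1 ≤ p → p < q → q ≤ k → at u p > at u q)
  × (∀ p q → suc k ≤ p → p < q → q ≤ n → at u p > at u q)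

ValidBridgeDiagram : ℕ → ℕ → List ℕ → List Bool → Set
ValidBridgeDiagram k n w J =
  Reduced n w × IsPDS n w J × AntiGrassmannian k n (finalPerm n (idPerm n) w J)

conjugates : ℕ → List (Perm × ℕ × Bool) → List Perm
conjugates n [] = []
conjugates n ((u , i , true) ∷ ss) = conjugates n ss
conjugates n ((u , i , false) ∷ ss) =
  mul (mul u (sPerm n i)) (inverse n u) ∷ conjugates n ss

IsBridgeSequence : ℕ → List ℕ → List Bool → List (ℕ × ℕ) → Set
IsBridgeSequence n w J bs =
  Pointwise (λ c ab → Σ ℕ λ a → Σ ℕ λ b → ab ≡ (a , b) × a < b × c ≡ transp n a b)
            (reverse (conjugates n (steps n (idPerm n) w J))) bs

Corresponds : ℕ → ℕ → List ℕ → List Bool → List ℕ → List (ℕ × ℕ) → Set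
Corresponds k n w J μ bs =
  (∀ c → (c ∈ take k (finalPerm n (idPerm n) w J) → c ∈ μ)
       × (c ∈ μ → c ∈ take k (finalPerm n (idPerm n) w J)))
  × IsBridgeSequence n w J bs

-- The diagram is produced by a walk that reads the bridges from the last
-- one to the first while writing the word from left to right.  Its
-- state is the permutation u = u_{(j)} of the subexpression and a
-- relabelling T with  s_{i_1} ⋯ s_{i_j} = T ∘ u.  Before bridge r is
-- read, u is laid out as L ++ M ++ R: M lists the endpoints of bridges
-- 1,…,r in increasing order, L the other points of μ and R the remaining
-- points, both in decreasing order.  Reading the bridge (a,b) writes a
-- letter outside J that exchanges the adjacent entries a < b of M, then
-- letters in J moving a into L and b into R (unless they are endpoints
-- of earlier bridges too).  Every letter swaps a pair that is ascending
-- for u, so J is a positive distinguished subexpression, and ascending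
-- for T ∘ u, so the word is reduced; the latter follows from an order
-- preservation property of bridge data.  Without lollipops all points
-- start in M, so the walk can start at the identity; at the end M is
-- empty and u = L ++ R is anti-Grassmannian with u([k]) = μ.

module Submission where

open import Defs
open import Data.Nat using (ℕ; zero; suc; _+_; _≤_; _<_; _>_; _≟_; _<?_; _<ᵇ_; _≡ᵇ_; s≤s; z≤n)
open import Data.Nat.Properties
open import Data.Bool using (Bool; true; false; if_then_else_) renaming (T to IsTrue)
open import Data.Unit using (tt)
open import Data.Empty using (⊥; ⊥-elim)
open import Data.Product using (Σ; ∃; _×_; _,_; proj₁; proj₂)
open import Data.Sum using (_⊎_; inj₁; inj₂; [_,_]′)
open import Data.List using (List; []; _∷_; _++_; map; length; applyUpTo; filter; reverse; take)
open import Data.List.Properties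
  using ( ++-assoc; ++-identityʳ; length-++; length-applyUpTo; length-map; map-applyUpTo; map-cong; map-∘
        ; map-id; map-id-local; unfold-reverse; reverse-map; reverse-involutive )
open import Data.List.Membership.Propositional using (_∈_; _∉_)
open import Data.List.Membership.DecPropositional _≟_ using (_∈?_)
open import Data.List.Membership.Propositional.Properties
  using (∈-applyUpTo⁺; ∈-applyUpTo⁻; ∈-insert; ∈-++⁻; ∈-++⁺ˡ; ∈-++⁺ʳ; ∈-∃++)
open import Data.List.Membership.Propositional.Properties.WithK using (unique∧set⇒bag)
open import Data.List.Relation.Unary.Any using (here; there)
open import Data.List.Relation.Unary.All as All using (All; []; _∷_)
import Data.List.Relation.Unary.All.Properties as AllP
open import Data.List.Relation.Unary.AllPairs as AP using (AllPairs; []; _∷_)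
import Data.List.Relation.Unary.AllPairs.Properties as APP
open import Data.List.Relation.Unary.Unique.Propositional using (Unique)
open import Data.List.Relation.Binary.Pointwise using (Pointwise; []; _∷_)
open import Data.List.Relation.Binary.Permutation.Propositional
  using (_↭_; prep; swap; ↭-refl; ↭-sym; ↭-trans; ↭⇒↭ₛ)
open import Data.List.Relation.Binary.Permutation.Propositional.Properties
  using (∈-resp-↭; All-resp-↭; ↭-length; shift)
import Data.List.Relation.Binary.Permutation.Setoid.Properties as SetoidPerm
open import Data.List.Relation.Binary.BagAndSetEquality using (∼bag⇒↭)
open import Function using (_∘_; id)
open import Function.Bundles using (_⇔_; mk⇔; Equivalence)
open import Function.Properties.Equivalence using () renaming (trans to ⇔-trans)
open import Function.Construct.Identity using (⇔-id)
open import Data.Sum.Function.Propositional using (_⊎-⇔_)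
open import Relation.Nullary using (¬_; yes; no)
open import Relation.Binary.Definitions using (tri<; tri≈; tri>)
open import Relation.Binary.PropositionalEquality
open import Algebra.Properties.CommutativeSemigroup +-commutativeSemigroup using (x∙yz≈y∙xz)

≡ᵇ-refl : ∀ m → (m ≡ᵇ m) ≡ true
≡ᵇ-refl zero = refl
≡ᵇ-refl (suc m) = ≡ᵇ-refl m

≡ᵇ-false : ∀ m n → m ≢ n → (m ≡ᵇ n) ≡ false
≡ᵇ-false m n m≢n with m ≡ᵇ n in eq
... | true = ⊥-elim (m≢n (≡ᵇ⇒≡ m n (subst IsTrue (sym eq) tt)))
... | false = refl

swapN-left : ∀ a b → swapN a b a ≡ b
swapN-left a b rewrite ≡ᵇ-refl a = refl

swapN-right : ∀ a b → a ≢ b → swapN a b b ≡ a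
swapN-right a b a≢b rewrite ≡ᵇ-false b a (a≢b ∘ sym) | ≡ᵇ-refl b = refl

swapN-other : ∀ a b x → x ≢ a → x ≢ b → swapN a b x ≡ x
swapN-other a b x x≢a x≢b rewrite ≡ᵇ-false x a x≢a | ≡ᵇ-false x b x≢b = refl

swapN-involutive : ∀ a b x → a ≢ b → swapN a b (swapN a b x) ≡ x
swapN-involutive a b x a≢b with x ≟ a | x ≟ b
... | yes refl | _ rewrite swapN-left x b = swapN-right x b a≢b
... | no _ | yes refl rewrite swapN-right a x a≢b = swapN-left a x
... | no x≢a | no x≢b rewrite swapN-other a b x x≢a x≢b = swapN-other a b x x≢a x≢b

swapN-suc : ∀ a b x → swapN (suc a) (suc b) (suc x) ≡ suc (swapN a b x)
swapN-suc a b x with x ≡ᵇ a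
... | true = refl
... | false with x ≡ᵇ b
...   | true = refl
...   | false = refl

InRange : ℕ → ℕ → Set
InRange n x = 1 ≤ x × x ≤ n

swapN-values : ∀ a b x → swapN a b x ≡ b ⊎ swapN a b x ≡ a ⊎ swapN a b x ≡ x
swapN-values a b x with x ≡ᵇ a
... | true = inj₁ refl
... | false with x ≡ᵇ b
...   | true = inj₂ (inj₁ refl)
...   | false = inj₂ (inj₂ refl)

swapN-range : ∀ n a b x → InRange n a → InRange n b → InRange n x → InRange n (swapN a b x)
swapN-range n a b x ra rb rx with swapN a b x | swapN-values a b x
... | _ | inj₁ refl = rb
... | _ | inj₂ (inj₁ refl) = ra
... | _ | inj₂ (inj₂ refl) = rx

-- Facts about one-line notation: at u (suc j) is the entry of u at
-- 0-based position j, and at u 0 = 0.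

at-zero : ∀ u → at u 0 ≡ 0
at-zero [] = refl
at-zero (x ∷ u) = refl

at-applyUpTo : ∀ (g : ℕ → ℕ) n j → j < n → at (applyUpTo g n) (suc j) ≡ g j
at-applyUpTo g (suc n) zero _ = refl
at-applyUpTo g (suc n) (suc j) (s≤s j<n) = at-applyUpTo (g ∘ suc) n j j<n

applyUpTo-at : ∀ u → applyUpTo (λ j → at u (suc j)) (length u) ≡ u
applyUpTo-at [] = refl
applyUpTo-at (x ∷ u) = cong (x ∷_) (applyUpTo-at u)

applyUpTo-cong : ∀ (f g : ℕ → ℕ) n → (∀ j → j < n → f j ≡ g j) → applyUpTo f n ≡ applyUpTo g n
applyUpTo-cong f g zero f≗g = refl
applyUpTo-cong f g (suc n) f≗g =
  cong₂ _∷_ (f≗g 0 (s≤s z≤n)) (applyUpTo-cong (f ∘ suc) (g ∘ suc) n (λ j j<n → f≗g (suc j) (s≤s j<n)))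

at-map : ∀ (f : ℕ → ℕ) u j → j < length u → at (map f u) (suc j) ≡ f (at u (suc j))
at-map f (x ∷ u) zero _ = refl
at-map f (x ∷ u) (suc j) (s≤s j<n) = at-map f u j j<n

-- since at A 0 = 0, composition commutes with evaluation everywhere
at-mul : ∀ A B j → at (mul A B) j ≡ at A (at B j)
at-mul A [] j = sym (at-zero A)
at-mul A (x ∷ B) zero = sym (at-zero A)
at-mul A (x ∷ B) (suc zero) = refl
at-mul A (x ∷ B) (suc (suc j)) = at-mul A B (suc j)

mul-assoc : ∀ A B C → mul (mul A B) C ≡ mul A (mul B C)
mul-assoc A B C = trans (map-cong (at-mul A B) C) (map-∘ C)

indexOf-at : ∀ x u → x ∈ u → ∃ λ j → indexOf x u ≡ suc j × j < length u × at u (suc j) ≡ x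
indexOf-at x (y ∷ u) x∈ with x ≟ y
... | yes refl rewrite ≡ᵇ-refl x = 0 , refl , s≤s z≤n , refl
... | no x≢y rewrite ≡ᵇ-false x y x≢y with x∈
...   | here x≡y = ⊥-elim (x≢y x≡y)
...   | there x∈u with indexOf-at x u x∈u
...     | j , idx , j<n , atj = suc j , cong suc idx , s≤s j<n , atj

IsPerm : ℕ → Perm → Set
IsPerm n u = u ↭ idPerm n

idPerm-ascending : ∀ n → AllPairs _<_ (idPerm n)
idPerm-ascending n = APP.applyUpTo⁺₁ suc n (λ i<j _ → s≤s i<j)

idPerm-range : ∀ n x → x ∈ idPerm n → InRange n x
idPerm-range n x x∈ with ∈-applyUpTo⁻ suc x∈
... | j , j<n , refl = s≤s z≤n , j<n

perm-length : ∀ n u → IsPerm n u → length u ≡ n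
perm-length n u u↭ = trans (↭-length u↭) (length-applyUpTo suc n)

perm-unique : ∀ n u → IsPerm n u → Unique u
perm-unique n u u↭ =
  SetoidPerm.Unique-resp-↭ (setoid ℕ) (↭⇒↭ₛ (↭-sym u↭))
    (AP.map (λ i<j → <⇒≢ i<j) (idPerm-ascending n))

idPerm-member : ∀ n x → InRange n x → x ∈ idPerm n
idPerm-member n (suc j) (_ , j<n) = ∈-applyUpTo⁺ suc j<n

perm-member : ∀ n u → IsPerm n u → ∀ x → InRange n x → x ∈ u
perm-member n u u↭ x rx = ∈-resp-↭ (↭-sym u↭) (idPerm-member n x rx)

below : ℕ → List ℕ → ℕ
below x xs = length (filter (λ y → y <? x) xs)

below-cons-< : ∀ x a xs → a < x → below x (a ∷ xs) ≡ suc (below x xs)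
below-cons-< x a xs a<x with a <ᵇ x in eq
... | true = refl
... | false = ⊥-elim (subst IsTrue eq (<⇒<ᵇ a<x))

below-cons-≮ : ∀ x a xs → ¬ a < x → below x (a ∷ xs) ≡ below x xs
below-cons-≮ x a xs a≮x with a <ᵇ x in eq
... | true = ⊥-elim (a≮x (<ᵇ⇒< a x (subst IsTrue (sym eq) tt)))
... | false = refl

below-cons : ∀ x a xs → below x (a ∷ xs) ≡ below x (a ∷ []) + below x xs
below-cons x a xs with a <ᵇ x
... | true = refl
... | false = refl

below-swap-head : ∀ x a b xs → below x (a ∷ b ∷ xs) ≡ below x (b ∷ a ∷ xs)
below-swap-head x a b xs = begin
  below x (a ∷ b ∷ xs)   ≡⟨ below-cons x a (b ∷ xs) ⟩
  [a] + below x (b ∷ xs) ≡⟨ cong ([a] +_) (below-cons x b xs) ⟩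
  [a] + ([b] + rest)     ≡⟨ x∙yz≈y∙xz [a] [b] rest ⟩
  [b] + ([a] + rest)     ≡⟨ cong ([b] +_) (below-cons x a xs) ⟨
  [b] + below x (a ∷ xs) ≡⟨ below-cons x b (a ∷ xs) ⟨
  below x (b ∷ a ∷ xs)   ∎
  where
  open ≡-Reasoning
  [a] [b] rest : ℕ
  [a] = below x (a ∷ [])
  [b] = below x (b ∷ [])
  rest = below x xs

inv-ascending : ∀ xs → AllPairs _<_ xs → inv xs ≡ 0
inv-ascending [] [] = refl
inv-ascending (x ∷ xs) (x<xs ∷ asc) = cong₂ _+_ (none-below xs x<xs) (inv-ascending xs asc)
  where
  none-below : ∀ ys → All (x <_) ys → below x ys ≡ 0
  none-below [] [] = refl
  none-below (y ∷ ys) (x<y ∷ x<ys) = trans (below-cons-≮ x y ys (<-asym x<y)) (none-below ys x<ys)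

-- Swap p u x y v: the entries of u at 0-based positions
-- p, p+1 are x, y, and v is u with these two entries exchanged; i.e.
-- v = u s_{p+1}.  Stating steps this way keeps all index arithmetic
-- inside the lemmas below.

data Swap : ℕ → Perm → ℕ → ℕ → Perm → Set where
  front : ∀ {x y C} → Swap 0 (x ∷ y ∷ C) x y (y ∷ x ∷ C)
  later : ∀ {p u x y v} z → Swap p u x y v → Swap (suc p) (z ∷ u) x y (z ∷ v)

swap-++ˡ : ∀ {p u x y v} A → Swap p u x y v → Swap (length A + p) (A ++ u) x y (A ++ v)
swap-++ˡ [] s = s
swap-++ˡ (z ∷ A) s = later z (swap-++ˡ A s)

swap-++ʳ : ∀ {p u x y v} B → Swap p u x y v → Swap p (u ++ B) x y (v ++ B)
swap-++ʳ B front = front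
swap-++ʳ B (later z s) = later z (swap-++ʳ B s)

swap-map : ∀ {p u x y v} (f : ℕ → ℕ) → Swap p u x y v → Swap p (map f u) (f x) (f y) (map f v)
swap-map f front = front
swap-map f (later z s) = later (f z) (swap-map f s)

swap-bound : ∀ {p u x y v} → Swap p u x y v → suc (suc p) ≤ length u
swap-bound front = s≤s (s≤s z≤n)
swap-bound (later z s) = s≤s (swap-bound s)

swap-letter : ∀ {n p u x y v} → length u ≡ n → Swap p u x y v → 1 ≤ suc p × suc (suc p) ≤ n
swap-letter len s = s≤s z≤n , ≤-trans (swap-bound s) (≤-reflexive len)

swap-↭ : ∀ {p u x y v} → Swap p u x y v → u ↭ v
swap-↭ front = swap _ _ ↭-refl
swap-↭ (later z s) = prep z (swap-↭ s)

swap-perm : ∀ {n p u x y v} → IsPerm n u → Swap p u x y v → IsPerm n v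
swap-perm u↭ s = ↭-trans (↭-sym (swap-↭ s)) u↭

swap-∈ : ∀ {p u x y v} → Swap p u x y v → x ∈ u × y ∈ u
swap-∈ front = here refl , there (here refl)
swap-∈ (later z s) with swap-∈ s
... | x∈ , y∈ = there x∈ , there y∈

swap-at : ∀ {p u x y v} → Swap p u x y v → ∀ j → at v (suc j) ≡ at u (suc (swapN p (suc p) j))
swap-at front zero = refl
swap-at front (suc zero) = refl
swap-at front (suc (suc j)) = refl
swap-at (later z s) zero = refl
swap-at {suc p} (later z s) (suc j) rewrite swapN-suc p (suc p) j = swap-at s j

swap-mul : ∀ {n p u x y v} → length u ≡ n → Swap p u x y v → mul u (sPerm n (suc p)) ≡ v
swap-mul {n} {p} {u} {v = v} refl s = begin
  map (at u) (applyUpTo (λ j → swapN (suc p) (suc (suc p)) (suc j)) (length u))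
    ≡⟨ map-applyUpTo _ (at u) (length u) ⟩
  applyUpTo (λ j → at u (swapN (suc p) (suc (suc p)) (suc j))) (length u)
    ≡⟨ applyUpTo-cong _ _ (length u) entry ⟩
  applyUpTo (λ j → at v (suc j)) (length u)
    ≡⟨ cong (applyUpTo (λ j → at v (suc j))) (↭-length (swap-↭ s)) ⟩
  applyUpTo (λ j → at v (suc j)) (length v)
    ≡⟨ applyUpTo-at v ⟩
  v ∎
  where
  open ≡-Reasoning
  entry : ∀ j → j < length u → at u (swapN (suc p) (suc (suc p)) (suc j)) ≡ at v (suc j)
  entry j _ rewrite swapN-suc p (suc p) j = sym (swap-at s j)

below-swap : ∀ {p u x y v} z → Swap p u x y v → below z v ≡ below z u
below-swap z (front {x} {y} {C}) = below-swap-head z y x C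
below-swap z (later {u = u} {v = v} w s) =
  trans (below-cons z w v) (trans (cong (below z (w ∷ []) +_) (below-swap z s)) (sym (below-cons z w u)))

swap-inv : ∀ {p u x y v} → x < y → Swap p u x y v → inv v ≡ suc (inv u)
swap-inv {x = x} {y} x<y (front {C = C}) rewrite below-cons-< y x C x<y | below-cons-≮ x y C (<-asym x<y) =
  cong suc (x∙yz≈y∙xz (below y C) (below x C) (inv C))
swap-inv x<y (later z s) rewrite below-swap z s | swap-inv x<y s = +-suc _ _

swap-values : ∀ {p u x y v} → Unique u → Swap p u x y v → map (swapN x y) u ≡ v
swap-values {x = x} {y} ((x≢y ∷ x∉C) ∷ y∉C ∷ _) front =
  cong₂ _∷_ (swapN-left x y) (cong₂ _∷_ (swapN-right x y x≢y)
    (map-id-local (All.map (λ (x≢z , y≢z) → swapN-other x y _ (x≢z ∘ sym) (y≢z ∘ sym))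
                           (All.zip (x∉C , y∉C)))))
swap-values {x = x} {y} (z∉u ∷ U) (later z s) =
  cong₂ _∷_ (swapN-other x y z (All.lookup z∉u (proj₁ (swap-∈ s))) (All.lookup z∉u (proj₂ (swap-∈ s))))
            (swap-values U s)

swap-conj : ∀ {n p u x y v} → IsPerm n u → Swap p u x y v →
            mul (mul u (sPerm n (suc p))) (inverse n u) ≡ transp n x y
swap-conj {n} {p} {u} {x} {y} {v} u↭ s = begin
  mul (mul u (sPerm n (suc p))) (inverse n u)
    ≡⟨ cong (λ w → mul w (inverse n u)) (swap-mul (perm-length n u u↭) s) ⟩
  map (at v) (applyUpTo (λ j → indexOf (suc j) u) n)
    ≡⟨ map-applyUpTo _ (at v) n ⟩
  applyUpTo (λ j → at v (indexOf (suc j) u)) n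
    ≡⟨ applyUpTo-cong _ _ n entry ⟩
  transp n x y ∎
  where
  open ≡-Reasoning
  entry : ∀ j → j < n → at v (indexOf (suc j) u) ≡ swapN x y (suc j)
  entry j j<n with indexOf-at (suc j) u (perm-member n u u↭ (suc j) (s≤s z≤n , j<n))
  ... | i , idx , i<len , at-i rewrite idx =
    begin
      at v (suc i)                ≡⟨ cong (λ w → at w (suc i)) (swap-values (perm-unique n u u↭) s) ⟨
      at (map (swapN x y) u) (suc i) ≡⟨ at-map (swapN x y) u i i<len ⟩
      swapN x y (at u (suc i))    ≡⟨ cong (swapN x y) at-i ⟩
      swapN x y (suc j)           ∎

-- Products of words.  wordPerm multiplies on the left, the walks below
-- on the right; associativity of composition connects the two.

Letters : ℕ → List ℕ → Set
Letters n w = All (λ i → 1 ≤ i × suc i ≤ n) w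

at-idPerm : ∀ n x → InRange n x → at (idPerm n) x ≡ x
at-idPerm n (suc j) (_ , j<n) = at-applyUpTo suc n j j<n

mul-id : ∀ P n → length P ≡ n → mul P (idPerm n) ≡ P
mul-id P _ refl = trans (map-applyUpTo suc (at P) (length P)) (applyUpTo-at P)

id-mul : ∀ n W → All (InRange n) W → mul (idPerm n) W ≡ W
id-mul n W inW = map-id-local (All.map (λ {x} → at-idPerm n x) inW)

wordPerm-range : ∀ n w → Letters n w → All (InRange n) (wordPerm n w)
wordPerm-range n [] [] = AllP.applyUpTo⁺₁ suc n (λ j<n → s≤s z≤n , j<n)
wordPerm-range n (i ∷ w) ((1≤i , i<n) ∷ ls) = AllP.map⁺ (All.map sPerm-range (wordPerm-range n w ls))
  where
  sPerm-range : ∀ {x} → InRange n x → InRange n (at (sPerm n i) x)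
  sPerm-range {suc j} rx@(_ , j<n) rewrite at-applyUpTo (λ x → swapN i (suc i) (suc x)) n j j<n =
    swapN-range n i (suc i) (suc j) (1≤i , <⇒≤ i<n) (s≤s z≤n , i<n) rx

-- A walk builds a word and a subexpression of it letter by
-- letter.  The state is the current permutation u = u_{(j)} together
-- with a relabelling T of values such that the product of the letters
-- read so far is T ∘ u.  A letter s_{p+1} is either kept (u moves to
-- u s_{p+1}) or recorded as a bridge (a,b) = u s_{p+1} u⁻¹ (u stays, T
-- absorbs the transposition).  In both cases the swapped pair must be
-- ascending for u (positivity of the subexpression) and for T ∘ u (so
-- that every letter lengthens the product: the word is reduced).

data Walk : (ℕ → ℕ) → Perm → List (ℕ × ℕ) → (ℕ → ℕ) → Perm → Set where
  done   : ∀ {T u} → Walk T u [] T u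
  keep   : ∀ {T p u x y v es T' u'} → Swap p u x y v → x < y → T x < T y →
           Walk T v es T' u' → Walk T u es T' u'
  bridge : ∀ {T p u a b v es T' u'} → Swap p u a b v → a < b → T a < T b →
           Walk (T ∘ swapN a b) u es T' u' → Walk T u ((a , b) ∷ es) T' u'

word : ∀ {T u es T' u'} → Walk T u es T' u' → List ℕ
word done = []
word (keep {p = p} _ _ _ W) = suc p ∷ word W
word (bridge {p = p} _ _ _ W) = suc p ∷ word W

choices : ∀ {T u es T' u'} → Walk T u es T' u' → List Bool
choices done = []
choices (keep _ _ _ W) = true ∷ choices W
choices (bridge _ _ _ W) = false ∷ choices W

module WalkSemantics (n : ℕ) where

  walk-perm : ∀ {T u es T' u'} → IsPerm n u → Walk T u es T' u' → IsPerm n u'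
  walk-perm u↭ done = u↭
  walk-perm u↭ (keep s _ _ W) = walk-perm (swap-perm u↭ s) W
  walk-perm u↭ (bridge _ _ _ W) = walk-perm u↭ W

  walk-letters : ∀ {T u es T' u'} → IsPerm n u → (W : Walk T u es T' u') → Letters n (word W)
  walk-letters u↭ done = []
  walk-letters {u = u} u↭ (keep s _ _ W) = swap-letter (perm-length n u u↭) s ∷ walk-letters (swap-perm u↭ s) W
  walk-letters {u = u} u↭ (bridge s _ _ W) = swap-letter (perm-length n u u↭) s ∷ walk-letters u↭ W

  walk-choices : ∀ {T u es T' u'} (W : Walk T u es T' u') → length (choices W) ≡ length (word W)
  walk-choices done = refl
  walk-choices (keep _ _ _ W) = cong suc (walk-choices W)
  walk-choices (bridge _ _ _ W) = cong suc (walk-choices W)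

  walk-final : ∀ {T u es T' u'} → IsPerm n u → (W : Walk T u es T' u') →
               finalPerm n u (word W) (choices W) ≡ u'
  walk-final u↭ done = refl
  walk-final {u = u} u↭ (keep s _ _ W)
    rewrite swap-mul (perm-length n u u↭) s = walk-final (swap-perm u↭ s) W
  walk-final u↭ (bridge _ _ _ W) = walk-final u↭ W

  swap-pds : ∀ {p u x y v} → length u ≡ n → Swap p u x y v → x < y → ∀ b → PDSStep n (u , suc p , b)
  swap-pds {p} {u} len s x<y b = first b , cover , λ u≡us → <-irrefl (cong inv u≡us) longer
    where
    longer : inv u < inv (mul u (sPerm n (suc p)))
    longer rewrite swap-mul len s | swap-inv x<y s = ≤-refl
    cover : Bruhat n u (mul u (sPerm n (suc p)))
    cover = bstep (suc p) (suc (suc p)) brefl (s≤s z≤n) ≤-refl (proj₂ (swap-letter len s)) longer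
    first : ∀ b → Bruhat n (if b then mul u (sPerm n (suc p)) else u) (mul u (sPerm n (suc p)))
    first true = brefl
    first false = cover

  walk-pds : ∀ {T u es T' u'} → IsPerm n u → (W : Walk T u es T' u') →
             All (PDSStep n) (steps n u (word W) (choices W))
  walk-pds u↭ done = []
  walk-pds {u = u} u↭ (keep s x<y _ W) rewrite swap-mul (perm-length n u u↭) s =
    swap-pds (perm-length n u u↭) s x<y true ∷ walk-pds (swap-perm u↭ s) W
  walk-pds {u = u} u↭ (bridge s a<b _ W) =
    swap-pds (perm-length n u u↭) s a<b false ∷ walk-pds u↭ W

  transpOf : ℕ × ℕ → Perm
  transpOf (a , b) = transp n a b

  walk-conj : ∀ {T u es T' u'} → IsPerm n u → (W : Walk T u es T' u') →
              conjugates n (steps n u (word W) (choices W)) ≡ map transpOf es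
  walk-conj u↭ done = refl
  walk-conj {u = u} u↭ (keep s _ _ W) rewrite swap-mul (perm-length n u u↭) s = walk-conj (swap-perm u↭ s) W
  walk-conj u↭ (bridge s _ _ W) = cong₂ _∷_ (swap-conj u↭ s) (walk-conj u↭ W)

  letter-inv : ∀ {p P x y Q} w → length P ≡ n → Swap p P x y Q → x < y →
               inv (mul Q (wordPerm n w)) ≡ inv Q + length w →
               inv (mul P (wordPerm n (suc p ∷ w))) ≡ inv P + suc (length w)
  letter-inv {p} {P} {Q = Q} w len s x<y rest = begin
    inv (mul P (mul (sPerm n (suc p)) (wordPerm n w)))  ≡⟨ cong inv (mul-assoc P (sPerm n (suc p)) (wordPerm n w)) ⟨
    inv (mul (mul P (sPerm n (suc p))) (wordPerm n w))  ≡⟨ cong (λ R → inv (mul R (wordPerm n w))) (swap-mul len s) ⟩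
    inv (mul Q (wordPerm n w))                          ≡⟨ rest ⟩
    inv Q + length w                                    ≡⟨ cong (_+ length w) (swap-inv x<y s) ⟩
    suc (inv P) + length w                              ≡⟨ +-suc (inv P) (length w) ⟨
    inv P + suc (length w)                              ∎
    where open ≡-Reasoning

  walk-inv : ∀ {T u es T' u'} → IsPerm n u → (W : Walk T u es T' u') →
             inv (mul (map T u) (wordPerm n (word W))) ≡ inv (map T u) + length (word W)
  walk-inv {T} {u} u↭ done =
    trans (cong inv (mul-id (map T u) n (trans (length-map T u) (perm-length n u u↭)))) (sym (+-identityʳ _))
  walk-inv {T} {u} u↭ (keep s x<y Tx<Ty W) =
    letter-inv (word W) (trans (length-map T u) (perm-length n u u↭)) (swap-map T s) Tx<Ty
               (walk-inv (swap-perm u↭ s) W)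
  walk-inv {T} {u} u↭ (bridge {a = a} {b} {v} s a<b Ta<Tb W) =
    letter-inv (word W) (trans (length-map T u) (perm-length n u u↭)) (swap-map T s) Ta<Tb
               (subst (λ P → inv (mul P (wordPerm n (word W))) ≡ inv P + length (word W)) relabelled (walk-inv u↭ W))
    where
    relabelled : map (T ∘ swapN a b) u ≡ map T v
    relabelled = trans (map-∘ u) (cong (map T) (swap-values (perm-unique n u u↭) s))

  walk-reduced : ∀ {es T' u'} (W : Walk id (idPerm n) es T' u') → Reduced n (word W)
  walk-reduced W = letters , sym (begin
    inv P                                ≡⟨ cong inv (id-mul n P (wordPerm-range n (word W) letters)) ⟨
    inv (mul (idPerm n) P)               ≡⟨ cong (λ Q → inv (mul Q P)) (map-id (idPerm n)) ⟨
    inv (mul (map id (idPerm n)) P)      ≡⟨ walk-inv ↭-refl W ⟩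
    inv (map id (idPerm n)) + length (word W) ≡⟨ cong (λ Q → inv Q + length (word W)) (map-id (idPerm n)) ⟩
    inv (idPerm n) + length (word W)     ≡⟨ cong (_+ length (word W)) (inv-ascending (idPerm n) (idPerm-ascending n)) ⟩
    length (word W)                      ∎)
    where
    open ≡-Reasoning
    P : Perm
    P = wordPerm n (word W)
    letters : Letters n (word W)
    letters = walk-letters ↭-refl W

  walk-is-pds : ∀ {es T' u'} (W : Walk id (idPerm n) es T' u') → IsPDS n (word W) (choices W)
  walk-is-pds W = walk-choices W , walk-pds ↭-refl W

walk-++ : ∀ {T u es₁ T₁ u₁ es₂ T₂ u₂} → Walk T u es₁ T₁ u₁ → Walk T₁ u₁ es₂ T₂ u₂ →
          Walk T u (es₁ ++ es₂) T₂ u₂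
walk-++ done W₂ = W₂
walk-++ (keep s x<y Tx<Ty W) W₂ = keep s x<y Tx<Ty (walk-++ W W₂)
walk-++ (bridge s a<b Ta<Tb W) W₂ = bridge s a<b Ta<Tb (walk-++ W W₂)

walk-from : ∀ {T u v es T' u'} → u ≡ v → Walk T v es T' u' → Walk T u es T' u'
walk-from refl W = W

walk-++ˡ : ∀ {T u es T' u'} A → Walk T u es T' u' → Walk T (A ++ u) es T' (A ++ u')
walk-++ˡ A done = done
walk-++ˡ A (keep s x<y Tx<Ty W) = keep (swap-++ˡ A s) x<y Tx<Ty (walk-++ˡ A W)
walk-++ˡ A (bridge s a<b Ta<Tb W) = bridge (swap-++ˡ A s) a<b Ta<Tb (walk-++ˡ A W)

move-left : ∀ {T a} ys B → All (λ y → y < a × T y < T a) ys → Walk T (ys ++ a ∷ B) [] T (a ∷ ys ++ B)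
move-left [] B [] = done
move-left (y ∷ ys) B ((y<a , Ty<Ta) ∷ smaller) =
  walk-++ (walk-++ˡ (y ∷ []) (move-left ys B smaller)) (keep front y<a Ty<Ta done)

move-right : ∀ {T b} ys B → All (λ y → b < y × T b < T y) ys → Walk T (b ∷ ys ++ B) [] T (ys ++ b ∷ B)
move-right [] B [] = done
move-right (y ∷ ys) B ((b<y , Tb<Ty) ∷ larger) =
  keep front b<y Tb<Ty (walk-++ˡ (y ∷ []) (move-right ys B larger))

apairs-split : ∀ {R : ℕ → ℕ → Set} xs {a ys} → AllPairs R (xs ++ a ∷ ys) →
               All (λ x → R x a) xs × All (R a) ys × AllPairs R (xs ++ ys)
apairs-split [] (a-ys ∷ rest) = [] , a-ys , rest
apairs-split (x ∷ xs) {a} {ys} (x-rest ∷ rest) with apairs-split xs rest | All-resp-↭ (shift a xs ys) x-rest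
... | xs-a , a-ys , rest' | x-a ∷ x-rest' = (x-a ∷ xs-a) , a-ys , (x-rest' ∷ rest')

insert-desc : ∀ a L → AllPairs _>_ L → a ∉ L →
              Σ (List ℕ) λ L₁ → Σ (List ℕ) λ L₂ →
                L ≡ L₁ ++ L₂ × All (a <_) L₁ × All (_< a) L₂ × AllPairs _>_ (L₁ ++ a ∷ L₂)
insert-desc a [] [] a∉L = [] , [] , refl , [] , [] , [] ∷ []
insert-desc a (x ∷ L) (x>L ∷ desc) a∉L with a <? x
... | yes a<x with insert-desc a L desc (a∉L ∘ there)
...   | L₁ , L₂ , refl , a<L₁ , L₂<a , desc' =
        x ∷ L₁ , L₂ , refl , a<x ∷ a<L₁ , L₂<a ,
        All-resp-↭ (↭-sym (shift a L₁ L₂)) (a<x ∷ x>L) ∷ desc'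
insert-desc a (x ∷ L) (x>L ∷ desc) a∉L | no a≮x =
  [] , x ∷ L , refl , [] , x<a ∷ L<a , (x<a ∷ L<a) ∷ x>L ∷ desc
  where
  x<a : x < a
  x<a = ≤∧≢⇒< (≮⇒≥ a≮x) (λ x≡a → a∉L (here (sym x≡a)))
  L<a : All (_< a) L
  L<a = All.map (λ y<x → <-trans y<x x<a) x>L

adjacent : ∀ {a b} M → AllPairs _<_ M → a ∈ M → b ∈ M → a < b →
           (∀ c → c ∈ M → a < c → c < b → ⊥) →
           Σ (List ℕ) λ M₁ → Σ (List ℕ) λ M₂ → M ≡ M₁ ++ a ∷ b ∷ M₂
adjacent (x ∷ M) _ (here refl) (here refl) a<b _ = ⊥-elim (<-irrefl refl a<b)
adjacent (x ∷ c ∷ M) _ (here refl) (there (here refl)) _ _ = [] , M , refl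
adjacent (x ∷ c ∷ M) ((x<c ∷ _) ∷ (c<M ∷ _)) (here refl) (there (there b∈M)) _ gap =
  ⊥-elim (gap c (there (here refl)) x<c (All.lookup c<M b∈M))
adjacent (x ∷ M) (x<M ∷ _) (there a∈M) (here refl) a<b _ = ⊥-elim (<-asym a<b (All.lookup x<M a∈M))
adjacent (x ∷ M) (_ ∷ asc) (there a∈M) (there b∈M) a<b gap
  with adjacent M asc a∈M b∈M a<b (λ c → gap c ∘ there)
... | M₁ , M₂ , refl = x ∷ M₁ , M₂ , refl

record Layout (PL PM PR : ℕ → Set) (u : Perm) : Set where
  constructor layout
  field
    L M R  : List ℕ
    split  : u ≡ L ++ M ++ R
    L-desc : AllPairs _>_ L
    M-asc  : AllPairs _<_ M
    R-desc : AllPairs _>_ R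
    L-mem  : ∀ x → x ∈ L ⇔ PL x
    M-mem  : ∀ x → x ∈ M ⇔ PM x
    R-mem  : ∀ x → x ∈ R ⇔ PR x

layout-resp : ∀ {PL PM PR PL' PM' PR' u} →
              (∀ x → PL x ⇔ PL' x) → (∀ x → PM x ⇔ PM' x) → (∀ x → PR x ⇔ PR' x) →
              Layout PL PM PR u → Layout PL' PM' PR' u
layout-resp eL eM eR (layout L M R split L-desc M-asc R-desc L-mem M-mem R-mem) =
  layout L M R split L-desc M-asc R-desc
         (λ x → ⇔-trans (L-mem x) (eL x)) (λ x → ⇔-trans (M-mem x) (eM x)) (λ x → ⇔-trans (R-mem x) (eR x))

∈-insert⇔ : ∀ {x a : ℕ} xs ys → x ∈ xs ++ a ∷ ys ⇔ (x ≡ a ⊎ x ∈ xs ++ ys)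
∈-insert⇔ {a = a} xs ys = mk⇔ to from
  where
  to : ∀ {x} → x ∈ xs ++ a ∷ ys → x ≡ a ⊎ x ∈ xs ++ ys
  to x∈ with ∈-resp-↭ (shift a xs ys) x∈
  ... | here x≡a = inj₁ x≡a
  ... | there x∈' = inj₂ x∈'
  from : ∀ {x} → x ≡ a ⊎ x ∈ xs ++ ys → x ∈ xs ++ a ∷ ys
  from (inj₁ refl) = ∈-insert xs
  from (inj₂ x∈) = ∈-resp-↭ (↭-sym (shift a xs ys)) (there x∈)

∈-delete⇔ : ∀ {P : ℕ → Set} {a} M₁ M₂ → All (_< a) M₁ → All (a <_) M₂ →
            (∀ x → x ∈ M₁ ++ a ∷ M₂ ⇔ P x) → ∀ x → x ∈ M₁ ++ M₂ ⇔ (P x × x ≢ a)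
∈-delete⇔ {P} {a} M₁ M₂ M₁<a a<M₂ mem x = mk⇔ to from
  where
  a∉ : a ∉ M₁ ++ M₂
  a∉ a∈ with ∈-++⁻ M₁ a∈
  ... | inj₁ a∈M₁ = <-irrefl refl (All.lookup M₁<a a∈M₁)
  ... | inj₂ a∈M₂ = <-irrefl refl (All.lookup a<M₂ a∈M₂)
  to : x ∈ M₁ ++ M₂ → P x × x ≢ a
  to x∈ = Equivalence.to (mem x) (Equivalence.from (∈-insert⇔ M₁ M₂) (inj₂ x∈)) , λ { refl → a∉ x∈ }
  from : P x × x ≢ a → x ∈ M₁ ++ M₂
  from (px , x≢a) with Equivalence.to (∈-insert⇔ M₁ M₂) (Equivalence.from (mem x) px)
  ... | inj₁ x≡a = ⊥-elim (x≢a x≡a)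
  ... | inj₂ x∈ = x∈

layout-adjacent : ∀ {PL PM PR u a b} → Layout PL PM PR u → PM a → PM b → a < b →
                  (∀ c → PM c → a < c → c < b → ⊥) → Σ ℕ λ p → Σ Perm λ v → Swap p u a b v
layout-adjacent {a = a} {b} (layout L M R refl _ M-asc _ _ M-mem _) pa pb a<b gap
  with adjacent M M-asc (Equivalence.from (M-mem a) pa) (Equivalence.from (M-mem b) pb) a<b
                (λ c c∈M → gap c (Equivalence.to (M-mem c) c∈M))
... | M₁ , M₂ , refl = _ , _ , swap-++ˡ L (swap-++ʳ R (swap-++ˡ M₁ front))

passing : ∀ {P : ℕ → Set} (T : ℕ → ℕ) {a ys} (R : ℕ → ℕ → Set) → All (λ y → R y a) ys →
          (∀ {y} → y ∈ ys → P y) → (∀ {y} → P y → R y a → R (T y) (T a)) →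
          All (λ y → R y a × R (T y) (T a)) ys
passing T R ys-a inP resp = All.tabulate (λ y∈ → All.lookup ys-a y∈ , resp (inP y∈) (All.lookup ys-a y∈))

retire-left : ∀ {PL PM PR u a} (T : ℕ → ℕ) → Layout PL PM PR u → PM a → ¬ PL a →
              (∀ y → y < a → PL y ⊎ PM y → T y < T a) →
              Σ Perm λ u' → Walk T u [] T u' ×
                Layout (λ x → x ≡ a ⊎ PL x) (λ x → PM x × x ≢ a) PR u'
retire-left {a = a} T (layout L M R refl L-desc M-asc R-desc L-mem M-mem R-mem) pa ¬pa smaller
  with ∈-∃++ (Equivalence.from (M-mem a) pa)
... | M₁ , M₂ , refl with apairs-split M₁ M-asc | insert-desc a L L-desc (¬pa ∘ Equivalence.to (L-mem a))
... | M₁<a , a<M₂ , M'-asc | L₁ , L₂ , refl , _ , L₂<a , L'-desc =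
  L₁ ++ a ∷ L₂ ++ M₁ ++ M₂ ++ R ,
  walk-from start (walk-++ W₁ W₂) ,
  layout (L₁ ++ a ∷ L₂) (M₁ ++ M₂) R end L'-desc M'-asc R-desc
         (λ x → ⇔-trans (∈-insert⇔ L₁ L₂) (⇔-id _ ⊎-⇔ L-mem x))
         (∈-delete⇔ M₁ M₂ M₁<a a<M₂ M-mem) R-mem
  where
  start : (L₁ ++ L₂) ++ (M₁ ++ a ∷ M₂) ++ R ≡ L₁ ++ L₂ ++ M₁ ++ a ∷ M₂ ++ R
  start = trans (++-assoc L₁ L₂ _) (cong (λ Z → L₁ ++ L₂ ++ Z) (++-assoc M₁ (a ∷ M₂) R))
  end : L₁ ++ a ∷ L₂ ++ M₁ ++ M₂ ++ R ≡ (L₁ ++ a ∷ L₂) ++ (M₁ ++ M₂) ++ R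
  end = sym (trans (++-assoc L₁ (a ∷ L₂) _) (cong (λ Z → L₁ ++ a ∷ L₂ ++ Z) (++-assoc M₁ M₂ R)))
  W₁ : Walk T (L₁ ++ L₂ ++ M₁ ++ a ∷ M₂ ++ R) [] T (L₁ ++ L₂ ++ a ∷ M₁ ++ M₂ ++ R)
  W₁ = walk-++ˡ L₁ (walk-++ˡ L₂ (move-left M₁ (M₂ ++ R)
         (passing T _<_ M₁<a (λ y∈ → Equivalence.to (M-mem _) (∈-++⁺ˡ y∈))
                             (λ py y<a → smaller _ y<a (inj₂ py)))))
  W₂ : Walk T (L₁ ++ L₂ ++ a ∷ M₁ ++ M₂ ++ R) [] T (L₁ ++ a ∷ L₂ ++ M₁ ++ M₂ ++ R)
  W₂ = walk-++ˡ L₁ (move-left L₂ (M₁ ++ M₂ ++ R)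
         (passing T _<_ L₂<a (λ y∈ → Equivalence.to (L-mem _) (∈-++⁺ʳ L₁ y∈))
                             (λ py y<a → smaller _ y<a (inj₁ py))))

retire-right : ∀ {PL PM PR u b} (T : ℕ → ℕ) → Layout PL PM PR u → PM b → ¬ PR b →
               (∀ y → b < y → PM y ⊎ PR y → T b < T y) →
               Σ Perm λ u' → Walk T u [] T u' ×
                 Layout PL (λ x → PM x × x ≢ b) (λ x → x ≡ b ⊎ PR x) u'
retire-right {b = b} T (layout L M R refl L-desc M-asc R-desc L-mem M-mem R-mem) pb ¬pb larger
  with ∈-∃++ (Equivalence.from (M-mem b) pb)
... | M₁ , M₂ , refl with apairs-split M₁ M-asc | insert-desc b R R-desc (¬pb ∘ Equivalence.to (R-mem b))
... | M₁<b , b<M₂ , M'-asc | R₁ , R₂ , refl , b<R₁ , _ , R'-desc =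
  L ++ M₁ ++ M₂ ++ R₁ ++ b ∷ R₂ ,
  walk-from start (walk-++ W₁ W₂) ,
  layout L (M₁ ++ M₂) (R₁ ++ b ∷ R₂) end L-desc M'-asc R'-desc
         L-mem (∈-delete⇔ M₁ M₂ M₁<b b<M₂ M-mem)
         (λ x → ⇔-trans (∈-insert⇔ R₁ R₂) (⇔-id _ ⊎-⇔ R-mem x))
  where
  start : L ++ (M₁ ++ b ∷ M₂) ++ R₁ ++ R₂ ≡ L ++ M₁ ++ b ∷ M₂ ++ R₁ ++ R₂
  start = cong (L ++_) (++-assoc M₁ (b ∷ M₂) _)
  end : L ++ M₁ ++ M₂ ++ R₁ ++ b ∷ R₂ ≡ L ++ (M₁ ++ M₂) ++ R₁ ++ b ∷ R₂
  end = cong (L ++_) (sym (++-assoc M₁ M₂ _))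
  W₁ : Walk T (L ++ M₁ ++ b ∷ M₂ ++ R₁ ++ R₂) [] T (L ++ M₁ ++ M₂ ++ b ∷ R₁ ++ R₂)
  W₁ = walk-++ˡ L (walk-++ˡ M₁ (move-right M₂ (R₁ ++ R₂)
         (passing T _>_ b<M₂ (λ y∈ → Equivalence.to (M-mem _) (∈-++⁺ʳ M₁ (there y∈)))
                             (λ py b<y → larger _ b<y (inj₁ py)))))
  W₂ : Walk T (L ++ M₁ ++ M₂ ++ b ∷ R₁ ++ R₂) [] T (L ++ M₁ ++ M₂ ++ R₁ ++ b ∷ R₂)
  W₂ = walk-++ˡ L (walk-++ˡ M₁ (walk-++ˡ M₂ (move-right R₁ R₂
         (passing T _>_ b<R₁ (λ y∈ → Equivalence.to (R-mem _) (∈-++⁺ˡ y∈))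
                             (λ py b<y → larger _ b<y (inj₂ py))))))

-- The affine permutations f_r stay
-- bounded, p ≤ f_r p ≤ p + n on the window, because every bridge (a,b)
-- has f(a) > f(b).  Call x left-safe for (f,E) if x ∈ E or f x = x + n
-- (an untouched point of μ), and right-safe if x ∈ E or f x = x.  Key
-- fact: if x < y, x is left-safe, y is right-safe and f x < f y, then
-- the transpositions of all remaining bridges keep x before y.  This
-- makes the letters of the walk ascending after relabelling.

module OrderPreservation (n : ℕ) (μ : List ℕ) where

  -- the composite of the transpositions of bs, the first one applied
  -- first: the relabelling reached by a walk that has read the bridges bs
  relabel : List (ℕ × ℕ) → ℕ → ℕ
  relabel [] x = x
  relabel ((a , b) ∷ rest) x = relabel rest (swapN a b x)

  Bounded : (ℕ → ℕ) → Set
  Bounded f = ∀ p → InRange n p → p ≤ f p × f p ≤ p + n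

  Safe : (ℕ → ℕ) → (ℕ → ℕ) → List ℕ → ℕ → Set
  Safe g f E x = x ∈ E ⊎ f x ≡ g x

  bounded-step : ∀ f a b → 1 ≤ a → a < b → b ≤ n → f a > f b → Bounded f → Bounded (f ∘ swapN a b)
  bounded-step f a b 1≤a a<b b≤n fb<fa bnd p rp with p ≟ a | p ≟ b
  ... | yes refl | _ rewrite swapN-left p b =
        <⇒≤ (<-≤-trans a<b (proj₁ (bnd b rb))) , ≤-trans (<⇒≤ fb<fa) (proj₂ (bnd p rp))
    where rb = ≤-trans 1≤a (<⇒≤ a<b) , b≤n
  ... | no _ | yes refl rewrite swapN-right a p (<⇒≢ a<b) =
        <⇒≤ (≤-<-trans (proj₁ (bnd p rp)) fb<fa) , ≤-trans (proj₂ (bnd a ra)) (+-monoˡ-≤ n (<⇒≤ a<b))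
    where ra = 1≤a , ≤-trans (<⇒≤ a<b) b≤n
  ... | no p≢a | no p≢b rewrite swapN-other a b p p≢a p≢b = bnd p rp

  safe-step : ∀ g f E a b x → a ≢ b → Safe g f E x → Safe g (f ∘ swapN a b) (a ∷ b ∷ E) (swapN a b x)
  safe-step g f E a b x a≢b sx with x ≟ a | x ≟ b
  ... | yes refl | _ rewrite swapN-left x b = inj₁ (there (here refl))
  ... | no _ | yes refl rewrite swapN-right a x a≢b = inj₁ (here refl)
  ... | no x≢a | no x≢b rewrite swapN-other a b x x≢a x≢b with sx
  ...   | inj₁ x∈E = inj₁ (there (there x∈E))
  ...   | inj₂ fx≡gx = inj₂ (trans (cong f (swapN-other a b x x≢a x≢b)) fx≡gx)

  beyond-bridge : ∀ f E a b y → f a > f b → (∀ c → a < c → c < b → c ∉ E) → Bounded f →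
                  InRange n b → a < y → Safe id f E y → f a < f y → b < y
  beyond-bridge f E a b y fb<fa gap bnd rb a<y sy fa<fy with <-cmp b y | sy
  ... | tri< b<y _ _ | _ = b<y
  ... | tri≈ _ refl _ | _ = ⊥-elim (<-asym fb<fa fa<fy)
  ... | tri> _ _ y<b | inj₁ y∈E = ⊥-elim (gap y a<y y<b y∈E)
  ... | tri> _ _ y<b | inj₂ fy≡y =
        ⊥-elim (<-asym fb<fa (<-≤-trans (<-trans fa<fy (subst (_< b) (sym fy≡y) y<b)) (proj₁ (bnd b rb))))

  before-bridge : ∀ f E a b x → f a > f b → (∀ c → a < c → c < b → c ∉ E) → Bounded f →
                  InRange n a → x ≢ a → x < b → Safe (_+ n) f E x → f x < f b → x < a
  before-bridge f E a b x fb<fa gap bnd ra x≢a x<b sx fx<fb with <-cmp x a | sx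
  ... | tri< x<a _ _ | _ = x<a
  ... | tri≈ _ x≡a _ | _ = ⊥-elim (x≢a x≡a)
  ... | tri> _ _ a<x | inj₁ x∈E = ⊥-elim (gap x a<x x<b x∈E)
  ... | tri> _ _ a<x | inj₂ fx≡x+n =
        ⊥-elim (<-irrefl refl (<-≤-trans (<-trans (subst (_< f b) fx≡x+n fx<fb) fb<fa)
                                         (≤-trans (proj₂ (bnd a ra)) (+-monoˡ-≤ n (<⇒≤ a<x)))))

  order-step : ∀ f E a b x y → 1 ≤ a → a < b → b ≤ n → f a > f b →
               (∀ c → a < c → c < b → c ∉ E) → Bounded f →
               x < y → Safe (_+ n) f E x → Safe id f E y → f x < f y → swapN a b x < swapN a b y
  order-step f E a b x y 1≤a a<b b≤n fb<fa gap bnd x<y sx sy fx<fy with x ≟ a | y ≟ b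
  ... | yes refl | _ = subst₂ _<_ (sym (swapN-left x b)) (sym (swapN-other x b y (>⇒≢ x<y) (>⇒≢ b<y))) b<y
    where
    b<y : b < y
    b<y = beyond-bridge f E x b y fb<fa gap bnd (≤-trans 1≤a (<⇒≤ a<b) , b≤n) x<y sy fx<fy
  ... | no x≢a | yes refl rewrite swapN-other a y x x≢a (<⇒≢ x<y) | swapN-right a y (<⇒≢ a<b) =
        before-bridge f E a y x fb<fa gap bnd (1≤a , ≤-trans (<⇒≤ a<b) b≤n) x≢a x<y sx fx<fy
  ... | no x≢a | no y≢b with x ≟ b | y ≟ a
  ...   | yes refl | _ rewrite swapN-right a x (<⇒≢ a<b) | swapN-other a x y (>⇒≢ (<-trans a<b x<y)) y≢b =
          <-trans a<b x<y
  ...   | no x≢b | yes refl rewrite swapN-other y b x x≢a x≢b | swapN-left y b = <-trans x<y a<b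
  ...   | no x≢b | no y≢a rewrite swapN-other a b x x≢a x≢b | swapN-other a b y y≢a y≢b = x<y

  order-preserved : ∀ f E bs → BridgesValid n μ f E bs → Bounded f →
                    ∀ {x y} → x < y → Safe (_+ n) f E x → Safe id f E y → f x < f y → relabel bs x < relabel bs y
  order-preserved f E [] _ _ x<y _ _ _ = x<y
  order-preserved f E ((a , b) ∷ rest) ((1≤a , a<b , b≤n) , fb<fa , gap , _ , _ , valid) bnd {x} {y} x<y sx sy fx<fy =
    order-preserved (f ∘ swapN a b) (a ∷ b ∷ E) rest valid (bounded-step f a b 1≤a a<b b≤n fb<fa bnd)
      (order-step f E a b x y 1≤a a<b b≤n fb<fa gap bnd x<y sx sy fx<fy)
      (safe-step (_+ n) f E a b x a≢b sx) (safe-step id f E a b y a≢b sy)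
      (subst₂ _<_ (sym (cong f (swapN-involutive a b x a≢b))) (sym (cong f (swapN-involutive a b y a≢b))) fx<fy)
    where
    a≢b = <⇒≢ a<b

-- Suppose bridges r,…,d have been read and E lists the
-- endpoints of bridges 1,…,r-1.  Then the permutation reached is laid
-- out as: L = the points of μ outside E (descending), M = E
-- (ascending), R = the other points outside E (descending).  Reading
-- bridge r-1 = (a,b) swaps the adjacent entries a < b of M, then
-- retires a to L and b to R unless they are endpoints of even earlier
-- bridges.

module Construction (n : ℕ) (μ : List ℕ) where
  open OrderPreservation n μ

  Outside : (ℕ → Set) → List ℕ → ℕ → Set
  Outside P E x = InRange n x × P x × x ∉ E

  Stage : List ℕ → Perm → Set
  Stage E u = Layout (Outside (_∈ μ) E) (_∈ E) (Outside (_∉ μ) E) u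

  Fresh : (ℕ → ℕ) → List ℕ → Set
  Fresh f E = ∀ p → p ∉ E → f p ≡ tμ n μ p

  InRangeAll : List ℕ → Set
  InRangeAll E = ∀ x → x ∈ E → InRange n x

  tμ-in : ∀ x → x ∈ μ → tμ n μ x ≡ x + n
  tμ-in x x∈μ with x ∈? μ
  ... | yes _ = refl
  ... | no x∉μ = ⊥-elim (x∉μ x∈μ)

  tμ-out : ∀ x → x ∉ μ → tμ n μ x ≡ x
  tμ-out x x∉μ with x ∈? μ
  ... | yes x∈μ = ⊥-elim (x∉μ x∈μ)
  ... | no _ = refl

  outside-drop : ∀ {P x F} → ¬ Outside P F x → ∀ y → Outside P (x ∷ F) y ⇔ Outside P F y
  outside-drop {P} {x} {F} ¬out y = mk⇔ (λ (r , p , y∉) → r , p , y∉ ∘ there) from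
    where
    from : Outside P F y → Outside P (x ∷ F) y
    from (r , p , y∉F) = r , p , λ { (here refl) → ¬out (r , p , y∉F) ; (there y∈F) → y∉F y∈F }

  outside-grow : ∀ {P x F} → InRange n x → P x → x ∉ F →
                 ∀ y → (y ≡ x ⊎ Outside P (x ∷ F) y) ⇔ Outside P F y
  outside-grow {P} {x} {F} rx px x∉F y = mk⇔ to from
    where
    to : y ≡ x ⊎ Outside P (x ∷ F) y → Outside P F y
    to (inj₁ refl) = rx , px , x∉F
    to (inj₂ (r , p , y∉)) = r , p , y∉ ∘ there
    from : Outside P F y → y ≡ x ⊎ Outside P (x ∷ F) y
    from (r , p , y∉F) with y ≟ x
    ... | yes y≡x = inj₁ y≡x
    ... | no y≢x = inj₂ (r , p , λ { (here y≡x) → y≢x y≡x ; (there y∈F) → y∉F y∈F })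

  endpoint-drop : ∀ {x : ℕ} {F} → x ∉ F → ∀ y → (y ∈ x ∷ F × y ≢ x) ⇔ y ∈ F
  endpoint-drop {x} {F} x∉F y = mk⇔ to (λ y∈F → there y∈F , λ { refl → x∉F y∈F })
    where
    to : y ∈ x ∷ F × y ≢ x → y ∈ F
    to (here y≡x , y≢x) = ⊥-elim (y≢x y≡x)
    to (there y∈F , _) = y∈F

  endpoint-repeat : ∀ {x : ℕ} {F} → x ∈ F → ∀ y → y ∈ x ∷ F ⇔ y ∈ F
  endpoint-repeat x∈F y = mk⇔ (λ { (here refl) → x∈F ; (there y∈F) → y∈F }) there

  stage-repeat : ∀ {x F u} → x ∈ F → Stage (x ∷ F) u → Stage F u
  stage-repeat {x} {F} x∈F =
    layout-resp (outside-drop (x∉outside (_∈ μ))) (endpoint-repeat x∈F) (outside-drop (x∉outside (_∉ μ)))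
    where
    x∉outside : ∀ P → ¬ Outside P F x
    x∉outside P (_ , _ , x∉F) = x∉F x∈F

  drop-left : ∀ {T u} x F → InRange n x → (x ∉ F → x ∈ μ) → Stage (x ∷ F) u →
              (x ∉ F → ∀ y → y < x → Outside (_∈ μ) (x ∷ F) y ⊎ y ∈ x ∷ F → T y < T x) →
              Σ Perm λ u' → Walk T u [] T u' × Stage F u'
  drop-left {T} x F rx in-μ S smaller with x ∈? F
  ... | yes x∈F = _ , done , stage-repeat x∈F S
  ... | no x∉F with retire-left T S (here refl) (λ o → proj₂ (proj₂ o) (here refl)) (smaller x∉F)
  ...   | u' , W , S' =
          u' , W , layout-resp (outside-grow rx (in-μ x∉F) x∉F) (endpoint-drop x∉F)
                               (outside-drop (λ o → proj₁ (proj₂ o) (in-μ x∉F))) S'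

  drop-right : ∀ {T u} x F → InRange n x → (x ∉ F → x ∉ μ) → Stage (x ∷ F) u →
               (x ∉ F → ∀ y → x < y → y ∈ x ∷ F ⊎ Outside (_∉ μ) (x ∷ F) y → T x < T y) →
               Σ Perm λ u' → Walk T u [] T u' × Stage F u'
  drop-right {T} x F rx out-μ S larger with x ∈? F
  ... | yes x∈F = _ , done , stage-repeat x∈F S
  ... | no x∉F with retire-right T S (here refl) (λ o → proj₂ (proj₂ o) (here refl)) (larger x∉F)
  ...   | u' , W , S' =
          u' , W , layout-resp (outside-drop (λ o → out-μ x∉F (proj₁ (proj₂ o)))) (endpoint-drop x∉F)
                               (outside-grow rx (out-μ x∉F) x∉F) S'

  -- Reading the bridge (a,b), given the affine permutation f and the
  -- endpoints E of the bridges before it; rest are the bridges after it.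
  module ReadBridge (f : ℕ → ℕ) (E : List ℕ) (a b : ℕ) (rest : List (ℕ × ℕ))
         (1≤a : 1 ≤ a) (a<b : a < b) (b≤n : b ≤ n) (fb<fa : f a > f b)
         (gap : ∀ c → a < c → c < b → c ∉ E) (a-new : a ∉ E → a ∈ μ) (b-new : b ∉ E → b ∉ μ)
         (valid : BridgesValid n μ (f ∘ swapN a b) (a ∷ b ∷ E) rest)
         (bnd : Bounded f) (fresh : Fresh f E) (E-range : InRangeAll E) where

    f' : ℕ → ℕ
    f' = f ∘ swapN a b

    E' : List ℕ
    E' = a ∷ b ∷ E

    T : ℕ → ℕ
    T = relabel rest

    a≢b : a ≢ b
    a≢b = <⇒≢ a<b

    ra : InRange n a
    ra = 1≤a , ≤-trans (<⇒≤ a<b) b≤n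

    rb : InRange n b
    rb = ≤-trans 1≤a (<⇒≤ a<b) , b≤n

    bounded' : Bounded f'
    bounded' = bounded-step f a b 1≤a a<b b≤n fb<fa bnd

    fresh' : Fresh f' E'
    fresh' p p∉E' =
      trans (cong f (swapN-other a b p (p∉E' ∘ here) (p∉E' ∘ there ∘ here))) (fresh p (p∉E' ∘ there ∘ there))

    E'-range : InRangeAll E'
    E'-range x (here refl) = ra
    E'-range x (there (here refl)) = rb
    E'-range x (there (there x∈E)) = E-range x x∈E

    f'-a : f' a ≡ f b
    f'-a = cong f (swapN-left a b)

    f'-b : f' b ≡ f a
    f'-b = cong f (swapN-right a b a≢b)

    keeps-order : ∀ {x y} → x < y → Safe (_+ n) f' E' x → Safe id f' E' y → f' x < f' y → T x < T y
    keeps-order = order-preserved f' E' rest valid bounded'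

    bridge-ascending : T a < T b
    bridge-ascending = keeps-order a<b (inj₁ (here refl)) (inj₁ (there (here refl)))
                                   (subst₂ _<_ (sym f'-a) (sym f'-b) fb<fa)

    left-ascending : a ∉ E → ∀ y → y < a → Outside (_∈ μ) E' y ⊎ y ∈ E' → T (swapN a b y) < T (swapN a b a)
    left-ascending a∉E y y<a cls rewrite swapN-other a b y (<⇒≢ y<a) (<⇒≢ (<-trans y<a a<b)) | swapN-left a b =
      keeps-order (<-trans y<a a<b) (safe cls) (inj₁ (there (here refl))) f'y<f'b
      where
      safe : Outside (_∈ μ) E' y ⊎ y ∈ E' → Safe (_+ n) f' E' y
      safe (inj₁ (_ , y∈μ , y∉E')) = inj₂ (trans (fresh' y y∉E') (tμ-in y y∈μ))
      safe (inj₂ y∈E') = inj₁ y∈E'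
      ry : InRange n y
      ry = [ proj₁ , E'-range y ]′ cls
      f'y<f'b : f' y < f' b
      f'y<f'b = begin-strict
        f' y     ≤⟨ proj₂ (bounded' y ry) ⟩
        y + n    <⟨ +-monoˡ-< n y<a ⟩
        a + n    ≡⟨ trans (fresh a a∉E) (tμ-in a (a-new a∉E)) ⟨
        f a      ≡⟨ f'-b ⟨
        f' b     ∎
        where open ≤-Reasoning

    right-ascending : b ∉ E → ∀ y → b < y → y ∈ b ∷ E ⊎ Outside (_∉ μ) (b ∷ E) y →
                      T (swapN a b b) < T (swapN a b y)
    right-ascending b∉E y b<y cls
      rewrite swapN-right a b a≢b | swapN-other a b y (>⇒≢ (<-trans a<b b<y)) (>⇒≢ b<y) =
      keeps-order a<y (inj₁ (here refl)) (safe cls) f'a<f'y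
      where
      a<y : a < y
      a<y = <-trans a<b b<y
      safe : y ∈ b ∷ E ⊎ Outside (_∉ μ) (b ∷ E) y → Safe id f' E' y
      safe (inj₁ y∈bE) = inj₁ (there y∈bE)
      safe (inj₂ (_ , y∉μ , y∉bE)) =
        inj₂ (trans (fresh' y λ { (here refl) → <-irrefl refl a<y ; (there y∈bE) → y∉bE y∈bE }) (tμ-out y y∉μ))
      ry : InRange n y
      ry = [ (λ y∈bE → E'-range y (there y∈bE)) , proj₁ ]′ cls
      f'a<f'y : f' a < f' y
      f'a<f'y = begin-strict
        f' a     ≡⟨ f'-a ⟩
        f b      ≡⟨ trans (fresh b b∉E) (tμ-out b (b-new b∉E)) ⟩
        b        <⟨ b<y ⟩
        y        ≤⟨ proj₁ (bounded' y ry) ⟩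
        f' y     ∎
        where open ≤-Reasoning

    inside-free : ∀ c → c ∈ E' → a < c → c < b → ⊥
    inside-free c (here refl) a<c _ = <-irrefl refl a<c
    inside-free c (there (here refl)) _ c<b = <-irrefl refl c<b
    inside-free c (there (there c∈E)) a<c c<b = gap c a<c c<b c∈E

    read-bridge : ∀ {u} → Stage E' u → Σ Perm λ u' → Walk T u ((a , b) ∷ []) (T ∘ swapN a b) u' × Stage E u'
    read-bridge S with layout-adjacent S (here refl) (there (here refl)) a<b inside-free
    ... | _ , _ , s with drop-left a (b ∷ E) ra (λ a∉bE → a-new (a∉bE ∘ there)) S
                                   (λ a∉bE → left-ascending (a∉bE ∘ there))
    ... | u₁ , W₁ , S₁ with drop-right b E rb b-new S₁ right-ascending
    ... | u₂ , W₂ , S₂ = u₂ , bridge s a<b bridge-ascending (walk-++ W₁ W₂) , S₂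

  tμ-bounded : Bounded (tμ n μ)
  tμ-bounded p _ with p ∈? μ
  ... | yes _ = m≤m+n p n , ≤-refl
  ... | no _ = ≤-refl , m≤m+n p n

  initial-stage : ∀ E → InRangeAll E → (∀ c → InRange n c → c ∈ E) → Stage E (idPerm n)
  initial-stage E E-range covered =
    layout [] (idPerm n) [] (sym (++-identityʳ (idPerm n))) [] (idPerm-ascending n) []
           (λ x → mk⇔ (λ ()) (λ (rx , _ , x∉E) → ⊥-elim (x∉E (covered x rx))))
           (λ x → mk⇔ (λ x∈ → covered x (idPerm-range n x x∈)) (λ x∈E → idPerm-member n x (E-range x x∈E)))
           (λ x → mk⇔ (λ ()) (λ (rx , _ , x∉E) → ⊥-elim (x∉E (covered x rx))))

  -- The
  -- walk starts at the identity, where every point is an endpoint (this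
  -- is where the absence of lollipops is used), and ends in the stage
  -- for E; its bridge transpositions are those of bs in reverse order.
  build : ∀ f E bs → BridgesValid n μ f E bs → Bounded f → Fresh f E → InRangeAll E →
          (∀ c → InRange n c → c ∈ E ⊎ c ∈ endpoints bs) →
          Σ Perm λ u → Walk id (idPerm n) (reverse bs) (relabel bs) u × Stage E u
  build f E [] _ _ _ E-range covered =
    idPerm n , done , initial-stage E E-range (λ c rc → [ id , (λ ()) ]′ (covered c rc))
  build f E ((a , b) ∷ rest) ((1≤a , a<b , b≤n) , fb<fa , gap , a-new , b-new , valid) bnd fresh E-range covered =
    result
    where
    open ReadBridge f E a b rest 1≤a a<b b≤n fb<fa gap a-new b-new valid bnd fresh E-range
    covered' : ∀ c → InRange n c → c ∈ E' ⊎ c ∈ endpoints rest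
    covered' c rc with covered c rc
    ... | inj₁ c∈E = inj₁ (there (there c∈E))
    ... | inj₂ (here c≡a) = inj₁ (here c≡a)
    ... | inj₂ (there (here c≡b)) = inj₁ (there (here c≡b))
    ... | inj₂ (there (there c∈rest)) = inj₂ c∈rest
    result : Σ Perm λ u → Walk id (idPerm n) (reverse ((a , b) ∷ rest)) (relabel ((a , b) ∷ rest)) u × Stage E u
    result with build f' E' rest valid bounded' fresh' E'-range covered'
    ... | u₁ , W₁ , S₁ with read-bridge S₁
    ... | u₂ , W₂ , S₂ =
      u₂ , subst (λ es → Walk id (idPerm n) es (T ∘ swapN a b) u₂) (sym (unfold-reverse (a , b) rest))
                 (walk-++ W₁ W₂) , S₂

  final-stage : ∀ {u} → (∀ x → x ∈ μ → InRange n x) → Stage [] u →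
                Σ (List ℕ) λ L → Σ (List ℕ) λ R →
                  u ≡ L ++ R × AllPairs _>_ L × AllPairs _>_ R × (∀ {x} → x ∈ L ⇔ x ∈ μ)
  final-stage μ-range (layout L [] R refl L-desc _ R-desc L-mem _ _) =
    L , R , refl , L-desc , R-desc ,
    λ {x} → ⇔-trans (L-mem x) (mk⇔ (λ (_ , x∈μ , _) → x∈μ) (λ x∈μ → μ-range x x∈μ , x∈μ , λ ()))
  final-stage μ-range (layout L (x ∷ M) R _ _ _ _ _ M-mem _) with Equivalence.to (M-mem x) (here refl)
  ... | ()

at-∈ : ∀ xs j → j < length xs → at xs (suc j) ∈ xs
at-∈ (x ∷ xs) zero _ = here refl
at-∈ (x ∷ xs) (suc j) (s≤s j<n) = there (at-∈ xs j j<n)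

at-++ˡ : ∀ L R j → j < length L → at (L ++ R) (suc j) ≡ at L (suc j)
at-++ˡ (x ∷ L) R zero _ = refl
at-++ˡ (x ∷ L) R (suc j) (s≤s j<n) = at-++ˡ L R j j<n

at-++ʳ : ∀ L R j → at (L ++ R) (suc (length L + j)) ≡ at R (suc j)
at-++ʳ [] R j = refl
at-++ʳ (x ∷ L) R j = at-++ʳ L R j

desc-at : ∀ xs p q → AllPairs _>_ xs → p < q → q < length xs → at xs (suc p) > at xs (suc q)
desc-at (x ∷ xs) zero (suc q) (x>xs ∷ _) _ (s≤s q<n) = All.lookup x>xs (at-∈ xs q q<n)
desc-at (x ∷ xs) (suc p) (suc q) (_ ∷ desc) (s≤s p<q) (s≤s q<n) = desc-at xs p q desc p<q q<n

beyond : ∀ k p → suc k ≤ p → ∃ λ i → p ≡ suc (k + i)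
beyond k p k<p with m≤n⇒∃[o]m+o≡n k<p
... | i , refl = i , refl

anti-grassmannian : ∀ k n L R → length L ≡ k → length L + length R ≡ n → AllPairs _>_ L → AllPairs _>_ R →
                    AntiGrassmannian k n (L ++ R)
anti-grassmannian _ _ L R refl refl L-desc R-desc = first-block , second-block
  where
  first-block : ∀ p q → 1 ≤ p → p < q → q ≤ length L → at (L ++ R) p > at (L ++ R) q
  first-block (suc p) (suc q) _ (s≤s p<q) q≤k
    rewrite at-++ˡ L R p (<-trans p<q q≤k) | at-++ˡ L R q q≤k = desc-at L p q L-desc p<q q≤k
  second-block : ∀ p q → suc (length L) ≤ p → p < q → q ≤ length L + length R → at (L ++ R) p > at (L ++ R) q
  second-block p q k<p p<q q≤n with beyond (length L) p k<p | beyond (length L) q (≤-trans k<p (<⇒≤ p<q))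
  ... | i , refl | j , refl rewrite at-++ʳ L R i | at-++ʳ L R j =
    desc-at R i j R-desc (+-cancelˡ-< (length L) i j (≤-pred p<q))
            (+-cancelˡ-≤ (length L) (suc j) (length R) (subst (_≤ length L + length R) (sym (+-suc (length L) j)) q≤n))

take-length : ∀ (L R : List ℕ) → take (length L) (L ++ R) ≡ L
take-length [] R = refl
take-length (x ∷ L) R = cong (x ∷_) (take-length L R)

unique-length : ∀ {xs ys : List ℕ} → Unique xs → Unique ys → (∀ {x} → x ∈ xs ⇔ x ∈ ys) →
                length xs ≡ length ys
unique-length U V same = ↭-length (∼bag⇒↭ (unique∧set⇒bag U V same))

bridges-ordered : ∀ {n μ f E} bs → BridgesValid n μ f E bs → All (λ ab → proj₁ ab < proj₂ ab) bs
bridges-ordered [] _ = []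
bridges-ordered (_ ∷ bs) ((_ , a<b , _) , _ , _ , _ , _ , valid) = a<b ∷ bridges-ordered bs valid

bridge-transpositions : ∀ n bs → All (λ ab → proj₁ ab < proj₂ ab) bs →
  Pointwise (λ c ab → Σ ℕ λ a → Σ ℕ λ b → ab ≡ (a , b) × a < b × c ≡ transp n a b)
            (map (WalkSemantics.transpOf n) bs) bs
bridge-transpositions n [] [] = []
bridge-transpositions n ((a , b) ∷ bs) (a<b ∷ ordered) = (a , b , refl , a<b , refl) ∷ bridge-transpositions n bs ordered

walk-diagram : ∀ k n μ bs {T' L R} → Unique μ → length μ ≡ k → All (λ ab → proj₁ ab < proj₂ ab) bs →
               (W : Walk id (idPerm n) (reverse bs) T' (L ++ R)) →
               AllPairs _>_ L → AllPairs _>_ R → (∀ {x} → x ∈ L ⇔ x ∈ μ) →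
               ValidBridgeDiagram k n (word W) (choices W) × Corresponds k n (word W) (choices W) μ bs
walk-diagram k n μ bs {L = L} {R} μ-unique |μ|≡k ordered W L-desc R-desc L⇔μ =
  (walk-reduced W , walk-is-pds W , subst (AntiGrassmannian k n) (sym final) anti) ,
  (λ c → (λ c∈ → Equivalence.to L⇔μ (subst (c ∈_) first-k c∈)) ,
         (λ c∈μ → subst (c ∈_) (sym first-k) (Equivalence.from L⇔μ c∈μ))) ,
  subst (λ cs → Pointwise _ cs bs) (sym read-bridges) (bridge-transpositions n bs ordered)
  where
  open WalkSemantics n
  final : finalPerm n (idPerm n) (word W) (choices W) ≡ L ++ R
  final = walk-final ↭-refl W
  |L|≡k : length L ≡ k
  |L|≡k = trans (unique-length (AP.map >⇒≢ L-desc) μ-unique L⇔μ) |μ|≡k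
  anti : AntiGrassmannian k n (L ++ R)
  anti = anti-grassmannian k n L R |L|≡k (trans (sym (length-++ L)) (perm-length n _ (walk-perm ↭-refl W))) L-desc R-desc
  first-k : take k (finalPerm n (idPerm n) (word W) (choices W)) ≡ L
  first-k = trans (cong (take k) final) (subst (λ m → take m (L ++ R) ≡ L) |L|≡k (take-length L R))
  read-bridges : reverse (conjugates n (steps n (idPerm n) (word W) (choices W))) ≡ map transpOf bs
  read-bridges = trans (cong reverse (trans (walk-conj ↭-refl W) (reverse-map transpOf bs))) (reverse-involutive _)

lemma4p2 : (k n : ℕ) (μ : List ℕ) (bs : List (ℕ × ℕ)) →
           BridgeGraphData k n μ bs → NoLollipops n bs →
           Σ (List ℕ) λ w → Σ (List Bool) λ J →
             ValidBridgeDiagram k n w J × Corresponds k n w J μ bs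
lemma4p2 k n μ bs ((μ-unique , μ-range , |μ|≡k) , valid) no-lollipops
  with Construction.build n μ (tμ n μ) [] bs valid (Construction.tμ-bounded n μ) (λ _ _ → refl) (λ _ ())
                          (λ c (1≤c , c≤n) → inj₂ (no-lollipops c 1≤c c≤n))
... | u , W , S with Construction.final-stage n μ (λ _ x∈μ → All.lookup μ-range x∈μ) S
... | L , R , refl , L-desc , R-desc , L⇔μ =
  word W , choices W , walk-diagram k n μ bs μ-unique |μ|≡k (bridges-ordered bs valid) W L-desc R-desc L⇔μ
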